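{- Let $F$ be a depth-$2$ circuit computing a linear operator. If all gates on the output layer of $F$ are linear boolean functions, then $F$ can be transformed into an equivalent linear depth-$2$ circuit of the same degree and width.
   Context: A depth-$2$ circuit of width $w$ with $n$ inputs and $m$ outputs has $w$ arbitrary boolean functions $h_1,\dots,h_w$ of the inputs on the middle layer and $m$ output gates $g_1,\dots,g_m$, where $g_i$ is a boolean function of the middle-layer values and of those inputs $x_j$ connected to it by a direct input-output wire; it computes $f$ if $f_i(\mathbf{x})=g_i(\mathbf{x},h_1(\mathbf{x}),\dots,h_w(\mathbf{x}))$. Its degree is the maximum over output gates of the number of direct input-output wires entering that gate. A linear operator is a map $\mathbf{x}\mapsto M\mathbf{x}$ over $GF_2$ for a $(0,1)$-matrix $M$. A boolean function is linear if it is a parity of (some of) its inputs over $GF_2$; a circuit is linear if all its gates are linear. Equivalent circuits compute the same operator. -}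

module Defs where

open import Data.Bool using (Bool; true; false; _∧_; _xor_; if_then_else_)
open import Data.Nat using (ℕ; zero; suc; _+_; _⊔_)
open import Data.Fin using (Fin; zero; suc)
open import Data.Product using (Σ; _×_; _,_)
open import Relation.Binary.PropositionalEquality using (_≡_)

parity : {k : ℕ} → (Fin k → Bool) → Bool
parity {zero}  v = false
parity {suc k} v = v zero xor parity (λ j → v (suc j))

count : {k : ℕ} → (Fin k → Bool) → ℕ
count {zero}  v = 0
count {suc k} v = (if v zero then 1 else 0) + count (λ j → v (suc j))

maxOver : {k : ℕ} → (Fin k → ℕ) → ℕ
maxOver {zero}  v = 0
maxOver {suc k} v = v zero ⊔ maxOver (λ j → v (suc j))

linOp : {m n : ℕ} → (Fin m → Fin n → Bool) → Fin m → (Fin n → Bool) → Bool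
linOp M i x = parity (λ j → M i j ∧ x j)

-- A depth-2 circuit with n inputs, m outputs and width w.
--  mid k      : the k-th middle gate, an arbitrary boolean function of the inputs
--  wire i j   : whether there is a direct wire from input x_j to output gate g_i
--  out i x y  : output gate g_i, given the inputs x and middle values y;
--               it may depend on x only through the wired inputs (out-local).
record Circuit (n m w : ℕ) : Set where
  field
    mid       : Fin w → (Fin n → Bool) → Bool
    wire      : Fin m → Fin n → Bool
    out       : Fin m → (Fin n → Bool) → (Fin w → Bool) → Bool
    out-local : ∀ i (x x' : Fin n → Bool) (y : Fin w → Bool) →
                (∀ j → wire i j ≡ true → x j ≡ x' j) → out i x y ≡ out i x' y

open Circuit public

eval : {n m w : ℕ} → Circuit n m w → Fin m → (Fin n → Bool) → Bool
eval C i x = out C i x (λ k → mid C k x)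

Computes : {n m w : ℕ} → Circuit n m w → (Fin m → (Fin n → Bool) → Bool) → Set
Computes C f = ∀ i x → eval C i x ≡ f i x

degree : {n m w : ℕ} → Circuit n m w → ℕ
degree C = maxOver (λ i → count (wire C i))

LinearMid : {n m w : ℕ} → Circuit n m w → Fin w → Set
LinearMid {n} C k = Σ (Fin n → Bool) λ c → ∀ x → mid C k x ≡ parity (λ j → c j ∧ x j)

LinearOut : {n m w : ℕ} → Circuit n m w → Fin m → Set
LinearOut {n} {m} {w} C i =
  Σ (Fin n → Bool) λ a → Σ (Fin w → Bool) λ b →
    (∀ j → a j ≡ true → wire C i j ≡ true) ×
    (∀ x y → out C i x y ≡ (parity (λ j → a j ∧ x j) xor parity (λ k → b k ∧ y k)))

LinearCircuit : {n m w : ℕ} → Circuit n m w → Set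
LinearCircuit C = (∀ k → LinearMid C k) × (∀ i → LinearOut C i)

-- Replace every middle gate h_k by its linear part x ↦ Σ_j h_k(e_j) x_j, keeping the
-- wires and the output gates. A linear output gate computes a·x ⊕ b·h(x); evaluated at
-- the unit vector e_j this gives a_j ⊕ Σ_k b_k h_k(e_j) = M_ij. After linearization the
-- output becomes the linear form whose j-th coefficient is that same expression, so it
-- computes row i of M on every input.
module Submission where

open import Defs
open import Data.Bool using (Bool; true; false; _∧_; _xor_)
open import Data.Bool.Properties
  using (∧-assoc; ∧-comm; ∧-zeroʳ; ∧-identityʳ; xor-identityʳ; ∧-distribʳ-xor;
         xor-∧-commutativeRing)
open import Data.Nat using (ℕ; zero; suc)
open import Data.Fin using (Fin; zero; suc)
open import Data.Product using (Σ; _×_; _,_)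
open import Algebra.Bundles using (CommutativeRing)
open import Algebra.Properties.CommutativeSemigroup
  (CommutativeRing.+-commutativeSemigroup xor-∧-commutativeRing) using (interchange)
open import Relation.Binary.PropositionalEquality
open ≡-Reasoning

infixl 7 _·_

_·_ : {k : ℕ} → (Fin k → Bool) → (Fin k → Bool) → Bool
u · v = parity (λ j → u j ∧ v j)

unit : {k : ℕ} → Fin k → Fin k → Bool
unit zero    zero    = true
unit zero    (suc _) = false
unit (suc _) zero    = false
unit (suc i) (suc j) = unit i j

parity-cong : {k : ℕ} {u v : Fin k → Bool} → (∀ j → u j ≡ v j) → parity u ≡ parity v
parity-cong {zero}  e = refl
parity-cong {suc k} e = cong₂ _xor_ (e zero) (parity-cong (λ j → e (suc j)))

parity-false : {k : ℕ} (u : Fin k → Bool) → (∀ j → u j ≡ false) → parity u ≡ false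
parity-false {zero}  u e = refl
parity-false {suc k} u e rewrite e zero = parity-false (λ j → u (suc j)) (λ j → e (suc j))

parity-xor : {k : ℕ} (u v : Fin k → Bool) →
             parity (λ j → u j xor v j) ≡ parity u xor parity v
parity-xor {zero}  u v = refl
parity-xor {suc k} u v = begin
  (u zero xor v zero) xor parity (λ j → u (suc j) xor v (suc j))
    ≡⟨ cong ((u zero xor v zero) xor_) (parity-xor (λ j → u (suc j)) (λ j → v (suc j))) ⟩
  (u zero xor v zero) xor (parity (λ j → u (suc j)) xor parity (λ j → v (suc j)))
    ≡⟨ interchange (u zero) (v zero) _ _ ⟩
  parity u xor parity v ∎

parity-∧ʳ : {k : ℕ} (u : Fin k → Bool) (c : Bool) →
            parity (λ j → u j ∧ c) ≡ parity u ∧ c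
parity-∧ʳ {zero}  u c = refl
parity-∧ʳ {suc k} u c = begin
  (u zero ∧ c) xor parity (λ j → u (suc j) ∧ c)
    ≡⟨ cong ((u zero ∧ c) xor_) (parity-∧ʳ (λ j → u (suc j)) c) ⟩
  (u zero ∧ c) xor (parity (λ j → u (suc j)) ∧ c)
    ≡⟨ sym (∧-distribʳ-xor c (u zero) _) ⟩
  parity u ∧ c ∎

parity-∧ˡ : {k : ℕ} (c : Bool) (u : Fin k → Bool) →
            parity (λ j → c ∧ u j) ≡ c ∧ parity u
parity-∧ˡ c u = begin
  parity (λ j → c ∧ u j) ≡⟨ parity-cong (λ j → ∧-comm c (u j)) ⟩
  parity (λ j → u j ∧ c) ≡⟨ parity-∧ʳ u c ⟩
  parity u ∧ c           ≡⟨ ∧-comm (parity u) c ⟩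
  c ∧ parity u           ∎

parity-swap : {K J : ℕ} (f : Fin K → Fin J → Bool) →
              parity (λ k → parity (f k)) ≡ parity (λ j → parity (λ k → f k j))
parity-swap {zero}  f = sym (parity-false (λ j → parity (λ k → f k j)) (λ _ → refl))
parity-swap {suc K} f = begin
  parity (f zero) xor parity (λ k → parity (f (suc k)))
    ≡⟨ cong (parity (f zero) xor_) (parity-swap (λ k → f (suc k))) ⟩
  parity (f zero) xor parity (λ j → parity (λ k → f (suc k) j))
    ≡⟨ sym (parity-xor (f zero) _) ⟩
  parity (λ j → parity (λ k → f k j)) ∎

·-unitʳ : {k : ℕ} (v : Fin k → Bool) (j : Fin k) → v · unit j ≡ v j
·-unitʳ {suc k} v zero = begin
  (v zero ∧ true) xor parity (λ l → v (suc l) ∧ false)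
    ≡⟨ cong₂ _xor_ (∧-identityʳ (v zero)) (parity-false _ (λ l → ∧-zeroʳ (v (suc l)))) ⟩
  v zero xor false
    ≡⟨ xor-identityʳ (v zero) ⟩
  v zero ∎
·-unitʳ {suc k} v (suc j) = begin
  (v zero ∧ false) xor (λ l → v (suc l)) · unit j ≡⟨ cong (_xor (λ l → v (suc l)) · unit j) (∧-zeroʳ (v zero)) ⟩
  (λ l → v (suc l)) · unit j                      ≡⟨ ·-unitʳ (λ l → v (suc l)) j ⟩
  v (suc j)                                       ∎

·-xorˡ : {k : ℕ} (u v x : Fin k → Bool) → (λ j → u j xor v j) · x ≡ u · x xor v · x
·-xorˡ u v x = begin
  parity (λ j → (u j xor v j) ∧ x j)        ≡⟨ parity-cong (λ j → ∧-distribʳ-xor (x j) (u j) (v j)) ⟩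
  parity (λ j → (u j ∧ x j) xor (v j ∧ x j)) ≡⟨ parity-xor (λ j → u j ∧ x j) (λ j → v j ∧ x j) ⟩
  u · x xor v · x                            ∎

·-matrix : {K J : ℕ} (b : Fin K → Bool) (U : Fin K → Fin J → Bool) (x : Fin J → Bool) →
           b · (λ k → U k · x) ≡ (λ j → b · (λ k → U k j)) · x
·-matrix b U x = begin
  parity (λ k → b k ∧ parity (λ j → U k j ∧ x j))
    ≡⟨ parity-cong (λ k → sym (parity-∧ˡ (b k) (λ j → U k j ∧ x j))) ⟩
  parity (λ k → parity (λ j → b k ∧ (U k j ∧ x j)))
    ≡⟨ parity-swap (λ k j → b k ∧ (U k j ∧ x j)) ⟩
  parity (λ j → parity (λ k → b k ∧ (U k j ∧ x j)))
    ≡⟨ parity-cong (λ j → parity-cong (λ k → sym (∧-assoc (b k) (U k j) (x j)))) ⟩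
  parity (λ j → parity (λ k → (b k ∧ U k j) ∧ x j))
    ≡⟨ parity-cong (λ j → parity-∧ʳ (λ k → b k ∧ U k j) (x j)) ⟩
  (λ j → b · (λ k → U k j)) · x ∎

linearizeMid : {n m w : ℕ} → Circuit n m w → Circuit n m w
linearizeMid F = record F { mid = λ k x → (λ j → mid F k (unit j)) · x }

linearizeMid-linear : {n m w : ℕ} (F : Circuit n m w) → (∀ i → LinearOut F i) →
                      LinearCircuit (linearizeMid F)
linearizeMid-linear F lin = (λ k → (λ j → mid F k (unit j)) , λ _ → refl) , lin

linearizeMid-computes : {n m w : ℕ} (M : Fin m → Fin n → Bool) (F : Circuit n m w) →
                        Computes F (linOp M) → (∀ i → LinearOut F i) →
                        Computes (linearizeMid F) (linOp M)
linearizeMid-computes {n} {m} {w} M F comp lin i x with lin i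
... | a , b , _ , out≡ = begin
  out F i x (λ k → H k · x)                   ≡⟨ out≡ x _ ⟩
  a · x xor b · (λ k → H k · x)               ≡⟨ cong (a · x xor_) (·-matrix b H x) ⟩
  a · x xor (λ j → b · (λ k → H k j)) · x     ≡⟨ sym (·-xorˡ a _ x) ⟩
  (λ j → a j xor b · (λ k → H k j)) · x       ≡⟨ parity-cong (λ j → cong (_∧ x j) (coefficient j)) ⟩
  linOp M i x                                 ∎
  where
  H : Fin w → Fin n → Bool
  H k j = mid F k (unit j)

  coefficient : ∀ j → a j xor b · (λ k → H k j) ≡ M i j
  coefficient j = begin
    a j xor b · (λ k → H k j)        ≡⟨ cong (_xor b · (λ k → H k j)) (sym (·-unitʳ a j)) ⟩
    a · unit j xor b · (λ k → H k j) ≡⟨ sym (out≡ (unit j) _) ⟩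
    eval F i (unit j)                ≡⟨ comp i (unit j) ⟩
    M i · unit j                     ≡⟨ ·-unitʳ (M i) j ⟩
    M i j                            ∎

lemma5 : {n m w : ℕ} (M : Fin m → Fin n → Bool) (F : Circuit n m w) →
         Computes F (linOp M) → (∀ i → LinearOut F i) →
         Σ (Circuit n m w) λ F' →
           Computes F' (linOp M) × LinearCircuit F' × degree F' ≡ degree F
lemma5 M F comp lin =
  linearizeMid F , linearizeMid-computes M F comp lin , linearizeMid-linear F lin , refl
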